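{- Let $G^+=(V,E^+)$ be a finite simple undirected graph, $\phi\ge0$, $0\le\eta<1$, and let $\mathcal{C}^*$ be a clustering with $\mathrm{obj}(\mathcal{C}^*)\le\phi$. Consider any execution of Algorithm ClusterPhi$(G^+,\phi,\eta)$. For each $i$, let $C^*_i$ be the cluster of $\mathcal{C}^*$ such that $L_i\cap V_{\mathrm{high}}=C^*_i\cap V_{\mathrm{high}}$. Then for every $i$, $C^*_i\cap V_i=C^*_i\cap V_{\mathrm{low}}$.
   Context: For $u\in V$, $N(u)$ is the set of neighbours of $u$ in $G^+$, $\deg(u)=|N(u)|$, and $N[u]=N(u)\cup\{u\}$. $\Delta$ denotes symmetric difference. A clustering $\mathcal{C}$ is a partition of $V$, and $\mathcal{C}_u$ denotes the cluster containing $u$. The disagreement of $u$ is $\rho_{\mathcal{C}}(u)=|N[u]\Delta\mathcal{C}_u|$, and $\mathrm{obj}(\mathcal{C})=\max_u\rho_{\mathcal{C}}(u)$. An $\eta'$-similarity query $\Delta_{\eta'}(u,v,t)$ returns: - $0$ if $|N[u]\Delta N[v]|>(1+\eta')t$; - $1$ if $|N[u]\Delta N[v]|\le t$; - arbitrarily $0$ or $1$ otherwise. Algorithm ClusterPhi$(G^+,\phi,\eta)$, main loop: 1. Let $E'$ be the set of pairs $\{u,v\}$ for which $\Delta_\eta(u,v,2\phi)$ returns $1$. 2. Let $V_{\mathrm{low}}=\{w:\deg(w)\le(3+\eta)\phi\}$ and $V_{\mathrm{high}}=V\setminus V_{\mathrm{low}}$. Set $V_1=V_{\mathrm{low}}$.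 3. Let $L_1,\dots,L_k$ be the connected components of $(V_{\mathrm{high}},E')$, in any order. 4. For $i=1,\dots,k$: - choose any $u_i\in L_i$; - let $R(u_i)=\{w\in V_i\cap N(u_i):\Delta_{\eta/2}(w,u_i,2\phi)\text{ returns }1\}$; - set $C_i=L_i\cup R(u_i)$ and $V_{i+1}=V_i\setminus R(u_i)$.
   Formalization: The parameters φ and η of the algorithm and of the bound on obj are taken to be rational numbers. -}

module Defs where

open import Data.Bool using (Bool; true; false; _xor_; _∧_)
open import Data.Nat as ℕ using (ℕ)
open import Data.Integer using (+_)
open import Data.Rational using (ℚ; _/_; _+_; _*_; _≤_; _<_; 0ℚ; 1ℚ; ½)
open import Data.Rational.Properties using (_≤?_)
open import Data.Fin using (Fin; _≟_)
open import Data.Fin.Subset using (Subset; _∈_; _∉_; ∣_∣; _∪_; _∩_; ⁅_⁆; _─_)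
open import Data.Vec using (Vec; tabulate; zipWith)
open import Data.List using (List; []; _∷_)
open import Data.Product using (_×_)
open import Relation.Binary.PropositionalEquality using (_≡_; _≢_)
open import Relation.Nullary using (¬_)
open import Relation.Nullary.Decidable using (⌊_⌋)

⟦_⟧ : ℕ → ℚ
⟦ k ⟧ = + k / 1

_Δ_ : ∀ {n} → Subset n → Subset n → Subset n
p Δ q = zipWith _xor_ p q

record Graph (n : ℕ) : Set where
  field
    N     : Fin n → Subset n
    sym   : ∀ u v → u ∈ N v → v ∈ N u
    irrefl : ∀ u → u ∉ N u

module _ {n : ℕ} (G : Graph n) where
  open Graph G

  N[_] : Fin n → Subset n
  N[ u ] = N u ∪ ⁅ u ⁆

  deg : Fin n → ℕ
  deg u = ∣ N u ∣

  -- A clustering given by a labelling: the cluster of u is {w | c w ≡ c u}.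
  -- (Every partition of Fin n arises this way.)
  cluster : (Fin n → Fin n) → Fin n → Subset n
  cluster c u = tabulate (λ w → ⌊ c w ≟ c u ⌋)

  ρ : (Fin n → Fin n) → Fin n → ℕ
  ρ c u = ∣ N[ u ] Δ cluster c u ∣

  -- obj(C) ≤ φ
  ObjLe : (Fin n → Fin n) → ℚ → Set
  ObjLe c φ = ∀ u → ⟦ ρ c u ⟧ ≤ φ

  -- q is a valid answer table for the η'-similarity query Δ_{η'}(u,v,t):
  -- returns 0 if |N[u]ΔN[v]| > (1+η')t, returns 1 if |N[u]ΔN[v]| ≤ t.
  SimOracle : ℚ → ℚ → (Fin n → Fin n → Bool) → Set
  SimOracle η' t q = ∀ u v →
      ((1ℚ + η') * t < ⟦ ∣ N[ u ] Δ N[ v ] ∣ ⟧ → q u v ≡ false)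
    × (⟦ ∣ N[ u ] Δ N[ v ] ∣ ⟧ ≤ t → q u v ≡ true)

  Vlow : ℚ → ℚ → Subset n
  Vlow φ η = tabulate (λ w → ⌊ ⟦ deg w ⟧ ≤? ((⟦ 3 ⟧ + η) * φ) ⌋)

  Vhigh : ℚ → ℚ → Subset n
  Vhigh φ η = tabulate (λ w → Data.Bool.not ⌊ ⟦ deg w ⟧ ≤? ((⟦ 3 ⟧ + η) * φ) ⌋)
    where import Data.Bool

  -- connectivity in the graph (S, E') where E' = {{u,v} : q u v = 1}
  -- (q is assumed symmetric, one answer per unordered pair)
  data Conn (S : Subset n) (q : Fin n → Fin n → Bool) : Fin n → Fin n → Set where
    here : ∀ {u} → Conn S q u u
    step : ∀ {u w v} → q u w ≡ true → w ∈ S → Conn S q w v → Conn S q u v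

  -- R(u) = {w ∈ S ∩ N(u) : Δ_{η/2}(w,u,2φ) returns 1}, answers given by q₂
  R : (Fin n → Fin n → Bool) → Subset n → Fin n → Subset n
  R q₂ S u = S ∩ (N u ∩ tabulate (λ w → q₂ w u))

  -- V after processing the representatives in the list, starting from S:
  -- V_{i+1} = V_i ∖ R(u_i)
  Vafter : (Fin n → Fin n → Bool) → Subset n → List (Fin n) → Subset n
  Vafter q₂ S [] = S
  Vafter q₂ S (x ∷ xs) = Vafter q₂ (S ─ R q₂ S x) xs

{-# OPTIONS --safe #-}
module Submission where

-- Processing a representative u_j removes from V_low only vertices w that the second oracle
-- declares similar to u_j, so it suffices that no such w lies in C*_i for j ≠ i.  Writing
-- a = u_i and y = u_j (in different clusters of C*, as they are not E'-connected), counting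
-- N[y] and N[a] against C*_a, C*_y and N[w] gives
--   deg y + deg a ≤ |N[w] Δ N[y]| + ρ(w) + 2ρ(y) + ρ(a) ≤ (1 + η/2)2φ + 4φ,
-- whereas both degrees exceed (3 + η)φ.

open import Defs
open import Data.Bool using (Bool; true; false; not; _xor_)
open import Data.Bool.Properties using (xor-comm; xor-identityʳ; T-≡)
open import Data.Nat as ℕ using (ℕ; suc; z≤n; s≤s)
import Data.Nat.Properties as ℕP
open import Data.Nat.Coprimality using (1-coprimeTo) renaming (sym to coprime-sym)
open import Data.Integer as ℤ using (+_)
import Data.Integer.Properties as ℤP
open import Data.Rational as ℚ using (ℚ; mkℚ; _≤_; _<_; _+_; _*_; 0ℚ; 1ℚ; ½; nonNegative)
import Data.Rational.Properties as ℚP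
open import Data.Rational.Solver using (module +-*-Solver)
open import Data.Fin as Fin using (Fin; toℕ)
open import Data.Fin.Properties using (suc-injective)
open import Data.Fin.Subset using (Subset; _∈_; _∉_; _⊆_; _∩_; _─_; ⊥; ∣_∣; inside; outside)
open import Data.Fin.Subset.Properties using (p⊆q⇒∣p∣≤∣q∣; ∣p∣≤∣p∪q∣; x∈p∩q⁻; drop-not-there)
open import Data.Vec using ([]; _∷_; here; there; tabulate)
open import Data.Vec.Properties using (zipWith-comm; zipWith-identityʳ; lookup∘tabulate; []=⇒lookup; lookup⇒[]=)
open import Data.List as List using (List; length; lookup; take)
open import Data.List.Relation.Unary.All using (All; []; _∷_)
open import Data.Product using (proj₁; proj₂; ∃-syntax)
open import Function using (_∘_)
open import Function.Bundles using (_⇔_; Equivalence)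
open import Relation.Binary.PropositionalEquality using (_≡_; _≢_; refl; sym; trans; cong; cong₂; subst; module ≡-Reasoning)
open import Relation.Nullary using (¬_; contradiction)
open import Relation.Nullary.Decidable using (⌊_⌋; toWitness; fromWitness; toWitnessFalse)

private
  variable
    n : ℕ

Disjoint : Subset n → Subset n → Set
Disjoint p q = ∀ {x} → x ∈ p → x ∉ q

drop-∷-Disjoint : ∀ {s t} {p q : Subset n} → Disjoint (s ∷ p) (t ∷ q) → Disjoint p q
drop-∷-Disjoint sp#tq x∈p x∈q = sp#tq (there x∈p) (there x∈q)

Δ-comm : ∀ (p q : Subset n) → p Δ q ≡ q Δ p
Δ-comm = zipWith-comm xor-comm

pΔ⊥≡p : ∀ (p : Subset n) → p Δ ⊥ ≡ p
pΔ⊥≡p = zipWith-identityʳ xor-identityʳ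

x∈p∧x∉q⇒x∈pΔq : ∀ {x} {p q : Subset n} → x ∈ p → x ∉ q → x ∈ p Δ q
x∈p∧x∉q⇒x∈pΔq {q = inside  ∷ q} here        x∉q = contradiction here x∉q
x∈p∧x∉q⇒x∈pΔq {q = outside ∷ q} here        x∉q = here
x∈p∧x∉q⇒x∈pΔq {q = _       ∷ q} (there x∈p) x∉q = there (x∈p∧x∉q⇒x∈pΔq x∈p (drop-not-there x∉q))

p∩q⊆pΔr : ∀ (p q : Subset n) {r} → Disjoint q r → p ∩ q ⊆ p Δ r
p∩q⊆pΔr p q q#r x∈p∩q = x∈p∧x∉q⇒x∈pΔq x∈p (q#r x∈q)
  where
  x∈p = proj₁ (x∈p∩q⁻ p q x∈p∩q)
  x∈q = proj₂ (x∈p∩q⁻ p q x∈p∩q)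

private
  1+m≤n+1+o : ∀ {m} n o → m ℕ.≤ n ℕ.+ o → suc m ℕ.≤ n ℕ.+ suc o
  1+m≤n+1+o n o m≤n+o = subst (ℕ._≤_ _) (sym (ℕP.+-suc n o)) (s≤s m≤n+o)

  m≤1+n+1+o : ∀ {m} n o → m ℕ.≤ n ℕ.+ o → m ℕ.≤ suc n ℕ.+ suc o
  m≤1+n+1+o n o m≤n+o = ℕP.≤-trans m≤n+o (ℕP.+-mono-≤ (ℕP.n≤1+n n) (ℕP.n≤1+n o))

∣pΔr∣≤∣pΔq∣+∣qΔr∣ : ∀ (p q r : Subset n) → ∣ p Δ r ∣ ℕ.≤ ∣ p Δ q ∣ ℕ.+ ∣ q Δ r ∣
∣pΔr∣≤∣pΔq∣+∣qΔr∣ []            []            []            = z≤n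
∣pΔr∣≤∣pΔq∣+∣qΔr∣ (inside  ∷ p) (inside  ∷ q) (inside  ∷ r) = ∣pΔr∣≤∣pΔq∣+∣qΔr∣ p q r
∣pΔr∣≤∣pΔq∣+∣qΔr∣ (inside  ∷ p) (inside  ∷ q) (outside ∷ r) = 1+m≤n+1+o _ _ (∣pΔr∣≤∣pΔq∣+∣qΔr∣ p q r)
∣pΔr∣≤∣pΔq∣+∣qΔr∣ (inside  ∷ p) (outside ∷ q) (inside  ∷ r) = m≤1+n+1+o _ _ (∣pΔr∣≤∣pΔq∣+∣qΔr∣ p q r)
∣pΔr∣≤∣pΔq∣+∣qΔr∣ (inside  ∷ p) (outside ∷ q) (outside ∷ r) = s≤s (∣pΔr∣≤∣pΔq∣+∣qΔr∣ p q r)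
∣pΔr∣≤∣pΔq∣+∣qΔr∣ (outside ∷ p) (inside  ∷ q) (inside  ∷ r) = s≤s (∣pΔr∣≤∣pΔq∣+∣qΔr∣ p q r)
∣pΔr∣≤∣pΔq∣+∣qΔr∣ (outside ∷ p) (inside  ∷ q) (outside ∷ r) = m≤1+n+1+o _ _ (∣pΔr∣≤∣pΔq∣+∣qΔr∣ p q r)
∣pΔr∣≤∣pΔq∣+∣qΔr∣ (outside ∷ p) (outside ∷ q) (inside  ∷ r) = 1+m≤n+1+o _ _ (∣pΔr∣≤∣pΔq∣+∣qΔr∣ p q r)
∣pΔr∣≤∣pΔq∣+∣qΔr∣ (outside ∷ p) (outside ∷ q) (outside ∷ r) = ∣pΔr∣≤∣pΔq∣+∣qΔr∣ p q r

∣p∣≤∣q∣+∣pΔq∣ : ∀ (p q : Subset n) → ∣ p ∣ ℕ.≤ ∣ q ∣ ℕ.+ ∣ p Δ q ∣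
∣p∣≤∣q∣+∣pΔq∣ p q = begin
  ∣ p ∣                   ≡⟨ cong ∣_∣ (pΔ⊥≡p p) ⟨
  ∣ p Δ ⊥ ∣               ≤⟨ ∣pΔr∣≤∣pΔq∣+∣qΔr∣ p q ⊥ ⟩
  ∣ p Δ q ∣ ℕ.+ ∣ q Δ ⊥ ∣ ≡⟨ cong (ℕ._+_ ∣ p Δ q ∣ ∘ ∣_∣) (pΔ⊥≡p q) ⟩
  ∣ p Δ q ∣ ℕ.+ ∣ q ∣     ≡⟨ ℕP.+-comm ∣ p Δ q ∣ ∣ q ∣ ⟩
  ∣ q ∣ ℕ.+ ∣ p Δ q ∣     ∎
  where open ℕP.≤-Reasoning

∣p∣+∣q∣≡∣pΔq∣+2∣p∩q∣ : ∀ (p q : Subset n) → ∣ p ∣ ℕ.+ ∣ q ∣ ≡ ∣ p Δ q ∣ ℕ.+ 2 ℕ.* ∣ p ∩ q ∣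
∣p∣+∣q∣≡∣pΔq∣+2∣p∩q∣ []            []            = refl
∣p∣+∣q∣≡∣pΔq∣+2∣p∩q∣ (outside ∷ p) (outside ∷ q) = ∣p∣+∣q∣≡∣pΔq∣+2∣p∩q∣ p q
∣p∣+∣q∣≡∣pΔq∣+2∣p∩q∣ (inside  ∷ p) (outside ∷ q) = cong suc (∣p∣+∣q∣≡∣pΔq∣+2∣p∩q∣ p q)
∣p∣+∣q∣≡∣pΔq∣+2∣p∩q∣ (outside ∷ p) (inside  ∷ q) =
  trans (ℕP.+-suc ∣ p ∣ ∣ q ∣) (cong suc (∣p∣+∣q∣≡∣pΔq∣+2∣p∩q∣ p q))
∣p∣+∣q∣≡∣pΔq∣+2∣p∩q∣ (inside  ∷ p) (inside  ∷ q) = begin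
  suc (∣ p ∣ ℕ.+ suc ∣ q ∣)                ≡⟨ cong suc (ℕP.+-suc ∣ p ∣ ∣ q ∣) ⟩
  2 ℕ.+ (∣ p ∣ ℕ.+ ∣ q ∣)                  ≡⟨ cong (2 ℕ.+_) (∣p∣+∣q∣≡∣pΔq∣+2∣p∩q∣ p q) ⟩
  2 ℕ.+ (∣ p Δ q ∣ ℕ.+ 2 ℕ.* ∣ p ∩ q ∣)    ≡⟨ cong suc (ℕP.+-suc ∣ p Δ q ∣ _) ⟨
  suc (∣ p Δ q ∣ ℕ.+ suc (2 ℕ.* ∣ p ∩ q ∣)) ≡⟨ ℕP.+-suc ∣ p Δ q ∣ _ ⟨
  ∣ p Δ q ∣ ℕ.+ (2 ℕ.+ 2 ℕ.* ∣ p ∩ q ∣)    ≡⟨ cong (ℕ._+_ ∣ p Δ q ∣) (ℕP.*-suc 2 ∣ p ∩ q ∣) ⟨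
  ∣ p Δ q ∣ ℕ.+ 2 ℕ.* suc ∣ p ∩ q ∣        ∎
  where open ≡-Reasoning

∣p∣+∣q∣≤∣pΔq∣+2∣pΔr∣ : ∀ (p q r : Subset n) → Disjoint q r →
                       ∣ p ∣ ℕ.+ ∣ q ∣ ℕ.≤ ∣ p Δ q ∣ ℕ.+ 2 ℕ.* ∣ p Δ r ∣
∣p∣+∣q∣≤∣pΔq∣+2∣pΔr∣ p q r q#r = begin
  ∣ p ∣ ℕ.+ ∣ q ∣                 ≡⟨ ∣p∣+∣q∣≡∣pΔq∣+2∣p∩q∣ p q ⟩
  ∣ p Δ q ∣ ℕ.+ 2 ℕ.* ∣ p ∩ q ∣   ≤⟨ ℕP.+-monoʳ-≤ ∣ p Δ q ∣ (ℕP.*-monoʳ-≤ 2 (p⊆q⇒∣p∣≤∣q∣ (p∩q⊆pΔr p q q#r))) ⟩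
  ∣ p Δ q ∣ ℕ.+ 2 ℕ.* ∣ p Δ r ∣   ∎
  where open ℕP.≤-Reasoning

∩-─-disjoint : ∀ (p q r : Subset n) → Disjoint p r → p ∩ (q ─ r) ≡ p ∩ q
∩-─-disjoint []            []      []            _   = refl
∩-─-disjoint (outside ∷ p) (_ ∷ q) (_       ∷ r) p#r = cong (outside ∷_) (∩-─-disjoint p q r (drop-∷-Disjoint p#r))
∩-─-disjoint (inside  ∷ p) (y ∷ q) (outside ∷ r) p#r = cong (y ∷_) (∩-─-disjoint p q r (drop-∷-Disjoint p#r))
∩-─-disjoint (inside  ∷ p) (_ ∷ q) (inside  ∷ r) p#r = contradiction here (p#r here)

All-take-lookup≢ : ∀ {A : Set} {P : A → Set} (xs : List A) (i : Fin (length xs)) →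
                   (∀ j → j ≢ i → P (lookup xs j)) → All P (take (toℕ i) xs)
All-take-lookup≢ (_ List.∷ _)  Fin.zero    _    = []
All-take-lookup≢ (_ List.∷ xs) (Fin.suc i) P≢i =
  P≢i Fin.zero (λ ()) ∷ All-take-lookup≢ xs i (λ j j≢i → P≢i (Fin.suc j) (j≢i ∘ suc-injective))

⟦⟧≡mkℚ : ∀ k → ⟦ k ⟧ ≡ mkℚ (+ k) 0 (coprime-sym (1-coprimeTo k))
⟦⟧≡mkℚ k = ℚP.normalize-coprime (coprime-sym (1-coprimeTo k))

⟦⟧-homo-+ : ∀ m n → ⟦ m ℕ.+ n ⟧ ≡ ⟦ m ⟧ + ⟦ n ⟧
⟦⟧-homo-+ m n rewrite ⟦⟧≡mkℚ m | ⟦⟧≡mkℚ n =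
  cong (λ z → z ℚ./ 1) (trans (ℤP.pos-+ m n) (sym (cong₂ ℤ._+_ (ℤP.*-identityʳ (+ m)) (ℤP.*-identityʳ (+ n)))))

⟦⟧-homo-* : ∀ m n → ⟦ m ℕ.* n ⟧ ≡ ⟦ m ⟧ * ⟦ n ⟧
⟦⟧-homo-* m n rewrite ⟦⟧≡mkℚ m | ⟦⟧≡mkℚ n = cong (λ z → z ℚ./ 1) (ℤP.pos-* m n)

⟦⟧-mono-≤ : ∀ {m n} → m ℕ.≤ n → ⟦ m ⟧ ≤ ⟦ n ⟧
⟦⟧-mono-≤ {m} {n} m≤n rewrite ⟦⟧≡mkℚ m | ⟦⟧≡mkℚ n = ℚ.*≤* (ℤP.*-monoʳ-≤-nonNeg (+ 1) (ℤ.+≤+ m≤n))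

⟦⟧-cancel-< : ∀ {m n} → ⟦ m ⟧ < ⟦ n ⟧ → m ℕ.< n
⟦⟧-cancel-< ⟦m⟧<⟦n⟧ = ℕP.≰⇒> (ℚP.<-irrefl refl ∘ ℚP.<-≤-trans ⟦m⟧<⟦n⟧ ∘ ⟦⟧-mono-≤)

module _ {φ η : ℚ} (φ≥0 : 0ℚ ≤ φ) (η≥0 : 0ℚ ≤ η) where
  open ℚP.≤-Reasoning

  [1+½η]2φ+4φ≤2[3+η]φ : (1ℚ + ½ * η) * (⟦ 2 ⟧ * φ) + φ + ⟦ 2 ⟧ * φ + φ ≤ (⟦ 3 ⟧ + η) * φ + (⟦ 3 ⟧ + η) * φ
  [1+½η]2φ+4φ≤2[3+η]φ = begin
    lhs              ≡⟨ ℚP.+-identityʳ lhs ⟨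
    lhs + 0ℚ         ≤⟨ ℚP.+-monoʳ-≤ lhs ηφ≥0 ⟩
    lhs + η * φ      ≡⟨ expand η φ ⟩
    (⟦ 3 ⟧ + η) * φ + (⟦ 3 ⟧ + η) * φ ∎
    where
    lhs = (1ℚ + ½ * η) * (⟦ 2 ⟧ * φ) + φ + ⟦ 2 ⟧ * φ + φ
    ηφ≥0 : 0ℚ ≤ η * φ
    ηφ≥0 = ℚP.nonNegative⁻¹ _ {{ℚP.nonNeg*nonNeg⇒nonNeg η {{nonNegative η≥0}} φ {{nonNegative φ≥0}}}}
    open +-*-Solver using (solve; _:+_; _:*_; _:=_; con)
    expand : ∀ η φ → (1ℚ + ½ * η) * (⟦ 2 ⟧ * φ) + φ + ⟦ 2 ⟧ * φ + φ + η * φ ≡ (⟦ 3 ⟧ + η) * φ + (⟦ 3 ⟧ + η) * φ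
    expand = solve 2 (λ η φ → (con 1ℚ :+ con ½ :* η) :* (con ⟦ 2 ⟧ :* φ) :+ φ :+ con ⟦ 2 ⟧ :* φ :+ φ :+ η :* φ
                              := (con ⟦ 3 ⟧ :+ η) :* φ :+ (con ⟦ 3 ⟧ :+ η) :* φ) refl

  two-high-degrees-exceed-budget : ∀ {d₁ d₂ D r₁ r₂ r₃} →
    (⟦ 3 ⟧ + η) * φ < ⟦ d₁ ⟧ → (⟦ 3 ⟧ + η) * φ < ⟦ d₂ ⟧ → ⟦ D ⟧ ≤ (1ℚ + ½ * η) * (⟦ 2 ⟧ * φ) →
    ⟦ r₁ ⟧ ≤ φ → ⟦ r₂ ⟧ ≤ φ → ⟦ r₃ ⟧ ≤ φ → D ℕ.+ r₁ ℕ.+ 2 ℕ.* r₂ ℕ.+ r₃ ℕ.< d₁ ℕ.+ d₂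
  two-high-degrees-exceed-budget {d₁} {d₂} {D} {r₁} {r₂} {r₃} d₁-high d₂-high D-small r₁≤φ r₂≤φ r₃≤φ =
    ⟦⟧-cancel-< {D ℕ.+ r₁ ℕ.+ 2 ℕ.* r₂ ℕ.+ r₃} {d₁ ℕ.+ d₂} (begin-strict
      ⟦ D ℕ.+ r₁ ℕ.+ 2 ℕ.* r₂ ℕ.+ r₃ ⟧                     ≡⟨ cast ⟩
      ⟦ D ⟧ + ⟦ r₁ ⟧ + ⟦ 2 ⟧ * ⟦ r₂ ⟧ + ⟦ r₃ ⟧              ≤⟨ ℚP.+-mono-≤ (ℚP.+-mono-≤ (ℚP.+-mono-≤ D-small r₁≤φ)
                                                                   (ℚP.*-monoˡ-≤-nonNeg ⟦ 2 ⟧ r₂≤φ)) r₃≤φ ⟩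
      (1ℚ + ½ * η) * (⟦ 2 ⟧ * φ) + φ + ⟦ 2 ⟧ * φ + φ      ≤⟨ [1+½η]2φ+4φ≤2[3+η]φ ⟩
      (⟦ 3 ⟧ + η) * φ + (⟦ 3 ⟧ + η) * φ                   <⟨ ℚP.+-mono-< d₁-high d₂-high ⟩
      ⟦ d₁ ⟧ + ⟦ d₂ ⟧                                     ≡⟨ ⟦⟧-homo-+ d₁ d₂ ⟨
      ⟦ d₁ ℕ.+ d₂ ⟧                                       ∎)
    where
    cast : ⟦ D ℕ.+ r₁ ℕ.+ 2 ℕ.* r₂ ℕ.+ r₃ ⟧ ≡ ⟦ D ⟧ + ⟦ r₁ ⟧ + ⟦ 2 ⟧ * ⟦ r₂ ⟧ + ⟦ r₃ ⟧
    cast = trans (⟦⟧-homo-+ (D ℕ.+ r₁ ℕ.+ 2 ℕ.* r₂) r₃) (cong (_+ ⟦ r₃ ⟧)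
             (trans (⟦⟧-homo-+ (D ℕ.+ r₁) (2 ℕ.* r₂)) (cong₂ _+_ (⟦⟧-homo-+ D r₁) (⟦⟧-homo-* 2 r₂))))

module _ (G : Graph n) where
  open Graph G using (N)

  ∈-cluster⁻ : ∀ {c : Fin n → Fin n} {u w} → w ∈ cluster G c u → c w ≡ c u
  ∈-cluster⁻ {c} {u} {w} w∈C =
    toWitness (Equivalence.from T-≡ (trans (sym (lookup∘tabulate (λ v → ⌊ c v Fin.≟ c u ⌋) w)) ([]=⇒lookup w∈C)))

  ∈-cluster⁺ : ∀ {c : Fin n → Fin n} {u w} → c w ≡ c u → w ∈ cluster G c u
  ∈-cluster⁺ {c} {u} {w} cw≡cu =
    lookup⇒[]= w _ (trans (lookup∘tabulate (λ v → ⌊ c v Fin.≟ c u ⌋) w) (Equivalence.to T-≡ (fromWitness cw≡cu)))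

  cluster-cong : ∀ {c : Fin n → Fin n} {u v} → c u ≡ c v → cluster G c u ≡ cluster G c v
  cluster-cong {c} = cong (λ t → tabulate (λ w → ⌊ c w Fin.≟ t ⌋))

  ∈R⇒similar : ∀ {q₂ S u w} → w ∈ R G q₂ S u → q₂ w u ≡ true
  ∈R⇒similar {q₂} {S} {u} {w} w∈R =
    trans (sym (lookup∘tabulate (λ v → q₂ v u) w)) ([]=⇒lookup (proj₂ (x∈p∩q⁻ (N u) _ (proj₂ (x∈p∩q⁻ S _ w∈R)))))

  ∈Vhigh⇒degree> : ∀ {φ η w} → w ∈ Vhigh G φ η → (⟦ 3 ⟧ + η) * φ < ⟦ deg G w ⟧
  ∈Vhigh⇒degree> {φ} {η} {w} w∈V = ℚP.≰⇒> (toWitnessFalse (Equivalence.from T-≡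
    (trans (sym (lookup∘tabulate (λ v → not ⌊ ⟦ deg G v ⟧ ℚP.≤? (⟦ 3 ⟧ + η) * φ ⌋) w)) ([]=⇒lookup w∈V))))

  similar⇒Δ≤ : ∀ {η′ t q u v} → SimOracle G η′ t q → q u v ≡ true → ⟦ ∣ N[_] G u Δ N[_] G v ∣ ⟧ ≤ (1ℚ + η′) * t
  similar⇒Δ≤ {u = u} {v} sim quv≡true = ℚP.≮⇒≥ λ far → true≢false (trans (sym quv≡true) (proj₁ (sim u v) far))
    where
    true≢false : true ≢ false
    true≢false ()

  clusters-disjoint : ∀ {c : Fin n → Fin n} {u v} → c u ≢ c v → Disjoint (cluster G c u) (cluster G c v)
  clusters-disjoint cu≢cv w∈Cu w∈Cv = cu≢cv (trans (sym (∈-cluster⁻ w∈Cu)) (∈-cluster⁻ w∈Cv))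

  deg≤∣N[]∣ : ∀ u → deg G u ℕ.≤ ∣ N[_] G u ∣
  deg≤∣N[]∣ u = ∣p∣≤∣p∪q∣ (N u) _

  degree-sum-bound : ∀ (c : Fin n → Fin n) {w y a} → c w ≡ c a → c y ≢ c a →
    deg G y ℕ.+ deg G a ℕ.≤ ∣ N[_] G w Δ N[_] G y ∣ ℕ.+ ρ G c w ℕ.+ 2 ℕ.* ρ G c y ℕ.+ ρ G c a
  degree-sum-bound c {w} {y} {a} cw≡ca cy≢ca = begin
    deg G y ℕ.+ deg G a                             ≤⟨ ℕP.+-mono-≤ (deg≤∣N[]∣ y) (deg≤∣N[]∣ a) ⟩
    ∣ N[y] ∣ ℕ.+ ∣ N[a] ∣                           ≤⟨ ℕP.+-monoʳ-≤ ∣ N[y] ∣ (∣p∣≤∣q∣+∣pΔq∣ N[a] Cₐ) ⟩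
    ∣ N[y] ∣ ℕ.+ (∣ Cₐ ∣ ℕ.+ ρ G c a)               ≡⟨ ℕP.+-assoc ∣ N[y] ∣ _ _ ⟨
    ∣ N[y] ∣ ℕ.+ ∣ Cₐ ∣ ℕ.+ ρ G c a                 ≤⟨ ℕP.+-monoˡ-≤ (ρ G c a) (∣p∣+∣q∣≤∣pΔq∣+2∣pΔr∣ N[y] Cₐ _ (clusters-disjoint (cy≢ca ∘ sym))) ⟩
    ∣ N[y] Δ Cₐ ∣ ℕ.+ 2 ℕ.* ρ G c y ℕ.+ ρ G c a     ≤⟨ ℕP.+-monoˡ-≤ (ρ G c a) (ℕP.+-monoˡ-≤ (2 ℕ.* ρ G c y) (∣pΔr∣≤∣pΔq∣+∣qΔr∣ N[y] N[w] Cₐ)) ⟩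
    ∣ N[y] Δ N[w] ∣ ℕ.+ ∣ N[w] Δ Cₐ ∣ ℕ.+ 2 ℕ.* ρ G c y ℕ.+ ρ G c a
      ≡⟨ cong (λ k → k ℕ.+ 2 ℕ.* ρ G c y ℕ.+ ρ G c a)
           (cong₂ ℕ._+_ (cong ∣_∣ (Δ-comm N[y] N[w])) (cong (λ C → ∣ N[w] Δ C ∣) (cluster-cong (sym cw≡ca)))) ⟩
    ∣ N[w] Δ N[y] ∣ ℕ.+ ρ G c w ℕ.+ 2 ℕ.* ρ G c y ℕ.+ ρ G c a ∎
    where
    open ℕP.≤-Reasoning
    N[w] = N[_] G w
    N[y] = N[_] G y
    N[a] = N[_] G a
    Cₐ = cluster G c a

  high-vertex-dissimilar-to-other-cluster :
    ∀ {φ η c q₂} → 0ℚ ≤ φ → 0ℚ ≤ η → ObjLe G c φ → SimOracle G (½ * η) (⟦ 2 ⟧ * φ) q₂ →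
    ∀ {w y a} → y ∈ Vhigh G φ η → a ∈ Vhigh G φ η → c w ≡ c a → c y ≢ c a → q₂ w y ≢ true
  high-vertex-dissimilar-to-other-cluster {φ} {η} {c} φ≥0 η≥0 obj sim {w} {y} {a} y-high a-high cw≡ca cy≢ca wy-similar =
    ℕP.<⇒≱ (two-high-degrees-exceed-budget φ≥0 η≥0 {deg G y} {deg G a} {∣ N[_] G w Δ N[_] G y ∣} {ρ G c w} {ρ G c y} {ρ G c a}
                                            (∈Vhigh⇒degree> {φ} {η} y-high) (∈Vhigh⇒degree> {φ} {η} a-high)
                                            (similar⇒Δ≤ {½ * η} {⟦ 2 ⟧ * φ} sim wy-similar) (obj w) (obj y) (obj a))
           (degree-sum-bound c cw≡ca cy≢ca)

  ∩-Vafter : ∀ {q₂ C} (S : Subset n) {us} → All (λ u → ∀ S → Disjoint C (R G q₂ S u)) us →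
             C ∩ Vafter G q₂ S us ≡ C ∩ S
  ∩-Vafter         S []                = refl
  ∩-Vafter {q₂} {C} S {u List.∷ _} (C#Rᵤ ∷ C#Rs) =
    trans (∩-Vafter (S ─ R G q₂ S u) C#Rs) (∩-─-disjoint C S (R G q₂ S u) (C#Rᵤ S))

mainTheorem5 : ∀ {n : ℕ} (G : Graph n) (φ η : ℚ) → 0ℚ ≤ φ → 0ℚ ≤ η → η < 1ℚ
    → (cstar : Fin n → Fin n) → ObjLe G cstar φ
    → (q : Fin n → Fin n → Bool) → (∀ u v → q u v ≡ q v u)
    → SimOracle G η (⟦ 2 ⟧ * φ) q
    → (q₂ : Fin n → Fin n → Bool) → SimOracle G (½ * η) (⟦ 2 ⟧ * φ) q₂
    → (us : List (Fin n))
    → (∀ i → lookup us i ∈ Vhigh G φ η)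
    → (∀ i j → i ≢ j → ¬ Conn G (Vhigh G φ η) q (lookup us i) (lookup us j))
    → (∀ w → w ∈ Vhigh G φ η → ∃[ i ] Conn G (Vhigh G φ η) q (lookup us i) w)
    → ∀ (i : Fin (length us)) (x : Fin n)
    → (∀ w → w ∈ Vhigh G φ η
         → Conn G (Vhigh G φ η) q (lookup us i) w ⇔ w ∈ cluster G cstar x)
    → cluster G cstar x ∩ Vafter G q₂ (Vlow G φ η) (take (toℕ i) us)
      ≡ cluster G cstar x ∩ Vlow G φ η
mainTheorem5 G φ η φ≥0 η≥0 _ c obj _ _ _ q₂ sim₂ us us-high us-apart _ i x component =
  ∩-Vafter G (Vlow G φ η) (All-take-lookup≢ us i earlier-R-avoids-Cₓ)
  where
  a = lookup us i
  ca≡cx : c a ≡ c x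
  ca≡cx = ∈-cluster⁻ G (Equivalence.to (component a (us-high i)) here)
  earlier-R-avoids-Cₓ : ∀ j → j ≢ i → ∀ S → Disjoint (cluster G c x) (R G q₂ S (lookup us j))
  earlier-R-avoids-Cₓ j j≢i S w∈Cₓ w∈R =
    high-vertex-dissimilar-to-other-cluster G φ≥0 η≥0 obj sim₂ (us-high j) (us-high i)
      (trans (∈-cluster⁻ G w∈Cₓ) (sym ca≡cx)) cy≢ca (∈R⇒similar G {q₂} w∈R)
    where
    cy≢ca : c (lookup us j) ≢ c a
    cy≢ca cy≡ca = us-apart i j (j≢i ∘ sym)
      (Equivalence.from (component (lookup us j) (us-high j)) (∈-cluster⁺ G {c} {x} (trans cy≡ca ca≡cx)))
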